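{- Let $F$ be a fullerene with $n\equiv 2\pmod 6$ vertices and $c(F)=\lfloor n/6\rfloor-3$, and let $(\mathcal{H},M)$ be a Clar structure of $F$. Then $|M|=10$ and each connected component of the $M$-associated graph has at most $10$ vertices of odd degree.
   Context: A fullerene is a finite, trivalent plane graph all of whose faces are pentagons and hexagons. For a perfect matching, a face is alternating if exactly half of its boundary edges lie in it. A resonant pattern is a set of pairwise vertex-disjoint faces all alternating with respect to one common perfect matching; $c(F)$ is the maximum size of a resonant pattern, and a Clar set is one of size $c(F)$. A Clar structure is a pair $(\mathcal{H},M)$ with $\mathcal{H}$ a Clar set and $M$ a perfect matching of $F$ minus the vertices of the faces in $\mathcal{H}$. An edge $e\in M$ exits a face $f$ if it shares exactly one vertex with $f$. The $M$-associated graph has one vertex for each face of $F$ exited by at least one edge of $M$, and, for each $e\in M$, one edge joining the vertices of the two faces that $e$ exits. -}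

module Defs where

open import Data.Nat using (ℕ; zero; suc; _+_; _*_; _≤_; _<_; _≤ᵇ_; _<ᵇ_; _%_)
open import Data.Fin using (Fin; toℕ) renaming (zero to fz; suc to fs)
import Data.Fin as Fin
open import Data.Bool using (Bool; true; false; T; _∧_; _∨_; _xor_; if_then_else_; not)
open import Data.List using (List; []; _∷_; length; upTo; allFin; cartesianProduct; map)
open import Data.Bool.ListAction using (and; or)
open import Data.Empty using (⊥)
open import Data.List.Relation.Unary.All using (All)
open import Data.List.Relation.Unary.AllPairs using (AllPairs)
open import Data.Product using (Σ; _×_; _,_; proj₁; proj₂; ∃)
open import Data.Product.Properties using (≡-dec)
open import Data.Sum using (_⊎_)
open import Relation.Binary.PropositionalEquality using (_≡_; _≢_)
open import Relation.Nullary using (¬_; Dec)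
open import Relation.Nullary.Decidable using (⌊_⌋)

-- Cubic plane graphs as combinatorial maps (rotation systems).
-- A graph with n vertices, all of degree 3, has darts (half-edges)
-- (v , i), v : Fin n, i : Fin 3.  The rotation σ cycles the three darts
-- at each vertex; the involution α pairs the two darts of an edge.
-- Faces are the orbits of φ = σ ∘ α.

Dart : ℕ → Set
Dart n = Fin n × Fin 3

vert : ∀ {n} → Dart n → Fin n
vert = proj₁

next3 : Fin 3 → Fin 3
next3 fz = fs fz
next3 (fs fz) = fs (fs fz)
next3 (fs (fs fz)) = fz

σ : ∀ {n} → Dart n → Dart n
σ (v , i) = v , next3 i

-- numeric code of a dart (used only to pick canonical representatives)
idx : ∀ {n} → Dart n → ℕ
idx (v , i) = 3 * toℕ v + toℕ i

_≟D_ : ∀ {n} → (d e : Dart n) → Dec (d ≡ e)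
_≟D_ = ≡-dec Fin._≟_ Fin._≟_

_==D_ : ∀ {n} → Dart n → Dart n → Bool
d ==D e = ⌊ d ≟D e ⌋

_==V_ : ∀ {n} → Fin n → Fin n → Bool
v ==V w = ⌊ v Fin.≟ w ⌋

allDarts : ∀ n → List (Dart n)
allDarts n = cartesianProduct (allFin n) (allFin 3)

countB : ∀ {A : Set} → (A → Bool) → List A → ℕ
countB p [] = 0
countB p (x ∷ xs) = if p x then suc (countB p xs) else countB p xs

iter : ∀ {A : Set} → (A → A) → ℕ → A → A
iter f zero x = x
iter f (suc k) x = f (iter f k x)

-- connectivity: reachability of darts via σ and α (and their inverses,
-- by symmetry of the closure)
data Conn {n : ℕ} (α : Dart n → Dart n) : Dart n → Dart n → Set where
  c-refl : ∀ {d} → Conn α d d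
  c-σ    : ∀ {d e} → Conn α d e → Conn α d (σ e)
  c-α    : ∀ {d e} → Conn α d e → Conn α d (α e)

record Fullerene : Set where
  field
    n  : ℕ
    α  : Dart n → Dart n
    α-invol  : ∀ d → α (α d) ≡ d
    noLoop   : ∀ d → vert (α d) ≢ vert d
    noMulti  : ∀ d e → vert d ≡ vert e → d ≢ e → vert (α d) ≢ vert (α e)
    connected : ∀ d e → Conn α d e

  φ : Dart n → Dart n
  φ d = σ (α d)

  -- length of the face (φ-orbit) of d; correct thanks to the axioms below
  faceLen : Dart n → ℕ
  faceLen d = if iter φ 5 d ==D d then 5 else 6

  -- the boundary walk of the face of d visits the vertices
  -- vert (φ^k d), k < faceLen d, and traverses the edges of the darts φ^k d.
  isRep : Dart n → Bool
  isRep d = and (map (λ k → idx d ≤ᵇ idx (iter φ k d)) (upTo 6))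

  numFaces : ℕ
  numFaces = countB isRep (allDarts n)

  numEdges : ℕ
  numEdges = countB (λ d → idx d <ᵇ idx (α d)) (allDarts n)

  field
    -- every face is a pentagon or a hexagon (a φ-orbit of length 5 or 6) ...
    faceShort : ∀ d k → 1 ≤ k → k ≤ 4 → iter φ k d ≢ d
    faceLen56 : ∀ d → iter φ 5 d ≡ d ⊎ iter φ 6 d ≡ d
    -- ... bounded by a cycle (distinct boundary vertices)
    faceCycle : ∀ d i j → i < faceLen d → j < faceLen d →
                vert (iter φ i d) ≡ vert (iter φ j d) → i ≡ j
    -- planarity: the map has genus 0 (Euler's formula V - E + F = 2)
    euler : n + numFaces ≡ numEdges + 2

module _ (F : Fullerene) where
  open Fullerene F

  -- faces are represented by any of their darts
  SameFace : Dart n → Dart n → Set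
  SameFace f g = Σ ℕ λ k → k < faceLen f × iter φ k f ≡ g

  onFaceB : Fin n → Dart n → Bool
  onFaceB v f = or (map (λ k → vert (iter φ k f) ==V v) (upTo (faceLen f)))

  OnFace : Fin n → Dart n → Set
  OnFace v f = T (onFaceB v f)

  -- a set of edges, given by its darts (symmetric under α)
  EdgeSet : Set
  EdgeSet = Dart n → Bool

  IsPerfectMatchingOf : (Fin n → Bool) → EdgeSet → Set
  IsPerfectMatchingOf removed M =
    (∀ d → M d ≡ M (α d)) ×
    (∀ d → T (M d) → ¬ T (removed (vert d))) ×
    (∀ v → ¬ T (removed v) → countB (λ i → M (v , i)) (allFin 3) ≡ 1)

  IsPerfectMatching : EdgeSet → Set
  IsPerfectMatching = IsPerfectMatchingOf (λ _ → false)

  edgeCount : EdgeSet → ℕ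
  edgeCount M = countB (λ d → M d ∧ (idx d <ᵇ idx (α d))) (allDarts n)

  Alternating : EdgeSet → Dart n → Set
  Alternating M f = 2 * countB (λ k → M (iter φ k f)) (upTo (faceLen f)) ≡ faceLen f

  DistinctDisjoint : Dart n → Dart n → Set
  DistinctDisjoint f g = ¬ SameFace f g × (∀ v → OnFace v f → OnFace v g → ⊥)

  IsResonantPattern : List (Dart n) → Set
  IsResonantPattern H =
    AllPairs DistinctDisjoint H ×
    Σ EdgeSet (λ M → IsPerfectMatching M × All (Alternating M) H)

  IsClarNumber : ℕ → Set
  IsClarNumber c =
    Σ (List (Dart n)) (λ H → IsResonantPattern H × length H ≡ c) ×
    (∀ H → IsResonantPattern H → length H ≤ c)

  IsClarSet : List (Dart n) → Set
  IsClarSet H = IsResonantPattern H × (∀ H' → IsResonantPattern H' → length H' ≤ length H)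

  coveredBy : List (Dart n) → Fin n → Bool
  coveredBy H v = or (map (onFaceB v) H)

  IsClarStructure : List (Dart n) → EdgeSet → Set
  IsClarStructure H M = IsClarSet H × IsPerfectMatchingOf (coveredBy H) M

  exitsB : Dart n → Dart n → Bool
  exitsB e f = onFaceB (vert e) f xor onFaceB (vert (α e)) f

  ExitsM : EdgeSet → Dart n → Dart n → Set
  ExitsM M e f = T (M e) × T (exitsB e f)

  IsAssocVertex : EdgeSet → Dart n → Set
  IsAssocVertex M f = Σ (Dart n) λ e → ExitsM M e f

  assocDegree : EdgeSet → Dart n → ℕ
  assocDegree M f =
    countB (λ d → M d ∧ (idx d <ᵇ idx (α d)) ∧ exitsB d f) (allDarts n)

  data AssocReach (M : EdgeSet) (f : Dart n) : Dart n → Set where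
    r-refl : AssocReach M f f
    r-same : ∀ {g h} → AssocReach M f g → SameFace g h → AssocReach M f h
    r-edge : ∀ {g h} e → AssocReach M f g → ExitsM M e g → ExitsM M e h →
             AssocReach M f h

module Submission where

open import Defs
open import Data.Nat using (ℕ; _≤_; _/_; _%_; _∸_)
open import Data.List using (List; length)
open import Data.List.Relation.Unary.All using (All)
open import Data.List.Relation.Unary.AllPairs using (AllPairs)
open import Data.Product using (_×_)
open import Relation.Binary.PropositionalEquality using (_≡_)
open import Relation.Nullary using (¬_; Dec)
open import Data.Bool using (Bool; T)
open import Data.Sum using (_⊎_)
open import Data.Product using (_,_; proj₁)

-- The faces of a Clar set are alternating, hence hexagons, and
-- disjoint, so they cover 6 |H| = 6 (⌊n/6⌋ - 3) vertices; M matches the other n - 6 |H|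
-- vertices, and since a fullerene has n ≥ 20 vertices (Euler's formula forces twelve
-- pentagons) this leaves exactly 20 vertices, i.e. 10 edges.  Each edge of M exits at most two faces; a component
-- reached through m edges has at most m + 1 faces, and if it has m + 1 faces then every edge
-- joins two of them, so its degrees add up to 2m.  With m = 10 this sum is even, so the
-- component cannot have 11 faces of odd degree.

module Truth where

  open import Data.Bool using (true; false; _∧_)
  open import Data.Unit using (tt)
  open import Data.Empty using (⊥-elim)
  open import Data.Product using (proj₂)
  open import Relation.Nullary using (yes; no)
  open import Relation.Binary.PropositionalEquality using (_≡_; refl; sym; trans)
  open import Relation.Nullary.Decidable using (⌊_⌋; isYes≗does; dec-true; dec-false)

  T-false : ∀ {a} → ¬ T a → a ≡ false
  T-false {true} ¬t = ⊥-elim (¬t tt)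
  T-false {false} _ = refl

  T-cong : ∀ {a b : Bool} → (T a → T b) → (T b → T a) → a ≡ b
  T-cong {true} {true} _ _ = refl
  T-cong {true} {false} f _ = ⊥-elim (f tt)
  T-cong {false} {true} _ g = ⊥-elim (g tt)
  T-cong {false} {false} _ _ = refl

  ⌊⌋-yes : ∀ {P : Set} (p : Dec P) → P → ⌊ p ⌋ ≡ true
  ⌊⌋-yes p x = trans (isYes≗does p) (dec-true p x)

  ⌊⌋-no : ∀ {P : Set} (p : Dec P) → ¬ P → ⌊ p ⌋ ≡ false
  ⌊⌋-no p ¬x = trans (isYes≗does p) (dec-false p ¬x)

  ⌊⌋-cong : ∀ {P Q : Set} (p : Dec P) (q : Dec Q) → (P → Q) → (Q → P) → ⌊ p ⌋ ≡ ⌊ q ⌋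
  ⌊⌋-cong (yes x) q f g = sym (⌊⌋-yes q (f x))
  ⌊⌋-cong (no ¬x) q f g = sym (⌊⌋-no q (λ y → ¬x (g y)))

  ⌊⌋-× : ∀ {P Q R : Set} (p : Dec P) (q : Dec Q) (r : Dec R) →
         (P → Q × R) → (Q × R → P) → ⌊ p ⌋ ≡ ⌊ q ⌋ ∧ ⌊ r ⌋
  ⌊⌋-× p (yes y) r f g = ⌊⌋-cong p r (λ x → proj₂ (f x)) (λ z → g (y , z))
  ⌊⌋-× p (no ¬y) r f g = ⌊⌋-no p (λ x → ¬y (proj₁ (f x)))

module FiniteSums where

  open import Data.Nat using (ℕ; zero; suc; _+_; _*_; _≤_; z≤n; s≤s)
  open import Data.Nat.Properties
  open import Algebra.Properties.CommutativeSemigroup +-commutativeSemigroup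
    using (interchange)
  open import Data.Bool using (Bool; true; false; _∧_; _∨_; not; T)
  open import Data.Unit using (tt)
  open import Data.Empty using (⊥; ⊥-elim)
  open import Data.List using (List; []; _∷_; length; map; _++_; tabulate; allFin; cartesianProduct; filterᵇ)
  open import Data.List.Relation.Unary.All using (All; []; _∷_)
  open import Data.Fin using (Fin) renaming (zero to fz; suc to fs)
  open import Data.Product using (_×_; _,_)
  open import Relation.Binary.PropositionalEquality
  open import Function using (_∘_)
  open import Defs using (countB)

  𝟙 : Bool → ℕ
  𝟙 true = 1
  𝟙 false = 0

  𝟙-∧ : ∀ a b → 𝟙 (a ∧ b) ≡ 𝟙 a * 𝟙 b
  𝟙-∧ true b = sym (+-identityʳ (𝟙 b))
  𝟙-∧ false b = refl

  𝟙-∨ : ∀ {a b} → (T a → T b → ⊥) → 𝟙 (a ∨ b) ≡ 𝟙 a + 𝟙 b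
  𝟙-∨ {true} {true} excl = ⊥-elim (excl tt tt)
  𝟙-∨ {true} {false} _ = refl
  𝟙-∨ {false} {b} _ = refl

  ∑ : ∀ {A : Set} → List A → (A → ℕ) → ℕ
  ∑ [] f = 0
  ∑ (x ∷ xs) f = f x + ∑ xs f

  module _ {A : Set} where

    countB≡∑𝟙 : (p : A → Bool) (xs : List A) → countB p xs ≡ ∑ xs (𝟙 ∘ p)
    countB≡∑𝟙 p [] = refl
    countB≡∑𝟙 p (x ∷ xs) with p x
    ... | true = cong suc (countB≡∑𝟙 p xs)
    ... | false = countB≡∑𝟙 p xs

    ∑-cong : (xs : List A) {f g : A → ℕ} → (∀ x → f x ≡ g x) → ∑ xs f ≡ ∑ xs g
    ∑-cong [] e = refl
    ∑-cong (x ∷ xs) e = cong₂ _+_ (e x) (∑-cong xs e)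

    ∑-congᴬ : (xs : List A) {f g : A → ℕ} → All (λ x → f x ≡ g x) xs → ∑ xs f ≡ ∑ xs g
    ∑-congᴬ [] [] = refl
    ∑-congᴬ (x ∷ xs) (e ∷ es) = cong₂ _+_ e (∑-congᴬ xs es)

    ∑-+ : (xs : List A) (f g : A → ℕ) → ∑ xs (λ x → f x + g x) ≡ ∑ xs f + ∑ xs g
    ∑-+ [] f g = refl
    ∑-+ (x ∷ xs) f g =
      trans (cong (f x + g x +_) (∑-+ xs f g)) (interchange (f x) (g x) (∑ xs f) (∑ xs g))

    ∑-*ʳ : (xs : List A) (f : A → ℕ) (c : ℕ) → ∑ xs (λ x → f x * c) ≡ ∑ xs f * c
    ∑-*ʳ [] f c = refl
    ∑-*ʳ (x ∷ xs) f c =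
      trans (cong (f x * c +_) (∑-*ʳ xs f c)) (sym (*-distribʳ-+ c (f x) (∑ xs f)))

    ∑-*ˡ : (xs : List A) (f : A → ℕ) (c : ℕ) → ∑ xs (λ x → c * f x) ≡ c * ∑ xs f
    ∑-*ˡ xs f c =
      trans (∑-cong xs (λ x → *-comm c (f x))) (trans (∑-*ʳ xs f c) (*-comm (∑ xs f) c))

    ∑-const : (xs : List A) (c : ℕ) → ∑ xs (λ _ → c) ≡ length xs * c
    ∑-const [] c = refl
    ∑-const (x ∷ xs) c = cong (c +_) (∑-const xs c)

    ∑-zero : (xs : List A) {f : A → ℕ} → (∀ x → f x ≡ 0) → ∑ xs f ≡ 0
    ∑-zero xs e = trans (∑-cong xs e) (trans (∑-const xs 0) (*-zeroʳ (length xs)))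

    ∑-++ : (xs ys : List A) (f : A → ℕ) → ∑ (xs ++ ys) f ≡ ∑ xs f + ∑ ys f
    ∑-++ [] ys f = refl
    ∑-++ (x ∷ xs) ys f = trans (cong (f x +_) (∑-++ xs ys f)) (sym (+-assoc (f x) _ _))

    ∑-mono : (xs : List A) {f g : A → ℕ} → (∀ x → f x ≤ g x) → ∑ xs f ≤ ∑ xs g
    ∑-mono [] e = z≤n
    ∑-mono (x ∷ xs) e = +-mono-≤ (e x) (∑-mono xs e)

  ∑-map : ∀ {A B : Set} (h : A → B) (xs : List A) (f : B → ℕ) → ∑ (map h xs) f ≡ ∑ xs (f ∘ h)
  ∑-map h [] f = refl
  ∑-map h (x ∷ xs) f = cong (f (h x) +_) (∑-map h xs f)

  ∑-swap : ∀ {A B : Set} (xs : List A) (ys : List B) (f : A → B → ℕ) →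
    ∑ xs (λ x → ∑ ys (f x)) ≡ ∑ ys (λ y → ∑ xs (λ x → f x y))
  ∑-swap [] ys f = sym (∑-zero ys (λ _ → refl))
  ∑-swap (x ∷ xs) ys f = trans (cong (∑ ys (f x) +_) (∑-swap xs ys f))
                            (sym (∑-+ ys (f x) (λ y → ∑ xs (λ x → f x y))))

  ∑-cartesian : ∀ {A B : Set} (xs : List A) (ys : List B) (f : A × B → ℕ) →
    ∑ (cartesianProduct xs ys) f ≡ ∑ xs (λ x → ∑ ys (λ y → f (x , y)))
  ∑-cartesian [] ys f = refl
  ∑-cartesian (x ∷ xs) ys f = trans (∑-++ (map (x ,_) ys) _ f)
    (cong₂ _+_ (∑-map (x ,_) ys f) (∑-cartesian xs ys f))

  ∑-tabulate : ∀ {A : Set} n (h : Fin n → A) (f : A → ℕ) → ∑ (tabulate h) f ≡ ∑ (allFin n) (f ∘ h)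
  ∑-tabulate zero h f = refl
  ∑-tabulate (suc n) h f =
    cong (f (h fz) +_) (trans (∑-tabulate n (h ∘ fs) f) (sym (∑-tabulate n fs (f ∘ h))))

  module _ {A : Set} where

    countB≤length : (p : A → Bool) (xs : List A) → countB p xs ≤ length xs
    countB≤length p [] = z≤n
    countB≤length p (x ∷ xs) with p x
    ... | true = s≤s (countB≤length p xs)
    ... | false = m≤n⇒m≤1+n (countB≤length p xs)

    countB-all : (p : A → Bool) (xs : List A) → countB p xs ≡ length xs → All (T ∘ p) xs
    countB-all p [] _ = []
    countB-all p (x ∷ xs) full with p x in eq
    ... | true = subst T (sym eq) tt ∷ countB-all p xs (suc-injective full)
    ... | false = ⊥-elim (<-irrefl full (s≤s (countB≤length p xs)))

    countB-not : (p : A → Bool) (xs : List A) → countB (not ∘ p) xs + countB p xs ≡ length xs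
    countB-not p [] = refl
    countB-not p (x ∷ xs) with p x
    ... | true = trans (+-suc _ _) (cong suc (countB-not p xs))
    ... | false = cong suc (countB-not p xs)

    countB-cong : {p q : A → Bool} (xs : List A) → (∀ x → p x ≡ q x) → countB p xs ≡ countB q xs
    countB-cong {p} {q} xs e = trans (countB≡∑𝟙 p xs) (trans (∑-cong xs (cong 𝟙 ∘ e)) (sym (countB≡∑𝟙 q xs)))


    length-filterᵇ : (p : A → Bool) (xs : List A) → length (filterᵇ p xs) ≡ countB p xs
    length-filterᵇ p [] = refl
    length-filterᵇ p (x ∷ xs) with p x
    ... | true = cong suc (length-filterᵇ p xs)
    ... | false = length-filterᵇ p xs

    countB-filterᵇ : (p q : A → Bool) (xs : List A) → countB q (filterᵇ p xs) ≡ countB (λ x → p x ∧ q x) xs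
    countB-filterᵇ p q [] = refl
    countB-filterᵇ p q (x ∷ xs) with p x
    ... | false = countB-filterᵇ p q xs
    ... | true with q x
    ... | true = cong suc (countB-filterᵇ p q xs)
    ... | false = countB-filterᵇ p q xs

module Enumerations where

  open import Data.Nat using (ℕ; suc; _+_; _*_)
  open import Data.Nat.Properties using (+-identityʳ; *-identityʳ)
  open import Data.Bool using (Bool; _∧_)
  open import Data.Bool.ListAction using (or)
  open import Data.List using (List; []; _∷_; length; map; tabulate; allFin; cartesianProduct)
  open import Data.List.Relation.Unary.All using (All; []; _∷_)
  open import Data.List.Relation.Unary.AllPairs using (AllPairs; []; _∷_)
  open import Data.Fin using (Fin) renaming (zero to fz; suc to fs)
  import Data.Fin as Fin
  import Data.Fin.Properties as Fin
  open import Data.Product using (_×_; _,_; proj₁; proj₂)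
  open import Data.Product.Properties using (≡-dec)
  open import Relation.Binary.Definitions using (DecidableEquality)
  open import Relation.Binary.PropositionalEquality
  open import Relation.Nullary using (¬_; yes; no)
  open import Relation.Nullary.Decidable using (⌊_⌋)
  open FiniteSums
  open Truth

  record Enumeration (A : Set) : Set where
    field
      elements : List A
      _≟_ : DecidableEquality A
      once : ∀ a → ∑ elements (λ y → 𝟙 ⌊ y ≟ a ⌋) ≡ 1

    once-sym : ∀ a → ∑ elements (λ y → 𝟙 ⌊ a ≟ y ⌋) ≡ 1
    once-sym a = trans (∑-cong elements (λ y → cong 𝟙 (⌊⌋-cong (a ≟ y) (y ≟ a) sym sym))) (once a)

    ∑-sift : ∀ a (g : A → ℕ) → ∑ elements (λ y → 𝟙 ⌊ y ≟ a ⌋ * g y) ≡ g a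
    ∑-sift a g = trans (∑-cong elements onDiagonal)
      (trans (∑-*ʳ elements _ (g a)) (trans (cong (_* g a) (once a)) (+-identityʳ (g a))))
      where
      onDiagonal : ∀ y → 𝟙 ⌊ y ≟ a ⌋ * g y ≡ 𝟙 ⌊ y ≟ a ⌋ * g a
      onDiagonal y with y ≟ a
      ... | yes refl = refl
      ... | no _ = refl

    ∑-reindex : (g h : A → A) → (∀ x → h (g x) ≡ x) → (∀ y → g (h y) ≡ y) →
                (f : A → ℕ) → ∑ elements (λ x → f (g x)) ≡ ∑ elements f
    ∑-reindex g h hg gh f = begin
        ∑ elements (λ x → f (g x))
          ≡⟨ ∑-cong elements (λ x → sym (∑-sift (g x) f)) ⟩
        ∑ elements (λ x → ∑ elements (λ y → 𝟙 ⌊ y ≟ g x ⌋ * f y))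
          ≡⟨ ∑-swap elements elements _ ⟩
        ∑ elements (λ y → ∑ elements (λ x → 𝟙 ⌊ y ≟ g x ⌋ * f y))
          ≡⟨ ∑-cong elements (λ y → ∑-cong elements (λ x → cong (λ b → 𝟙 b * f y) (inverse x y))) ⟩
        ∑ elements (λ y → ∑ elements (λ x → 𝟙 ⌊ x ≟ h y ⌋ * f y))
          ≡⟨ ∑-cong elements (λ y → ∑-sift (h y) (λ _ → f y)) ⟩
        ∑ elements f ∎
      where
      open ≡-Reasoning
      inverse : ∀ x y → ⌊ y ≟ g x ⌋ ≡ ⌊ x ≟ h y ⌋
      inverse x y = ⌊⌋-cong (y ≟ g x) (x ≟ h y)
        (λ e → trans (sym (hg x)) (cong h (sym e))) (λ e → trans (sym (gh y)) (cong g (sym e)))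

    memberB : List A → A → Bool
    memberB xs y = or (map (λ x → ⌊ x ≟ y ⌋) xs)

    𝟙-memberB : (xs : List A) → AllPairs (λ a b → ¬ a ≡ b) xs → ∀ y →
                𝟙 (memberB xs y) ≡ ∑ xs (λ x → 𝟙 ⌊ x ≟ y ⌋)
    𝟙-memberB [] [] y = refl
    𝟙-memberB (x ∷ xs) (x∉xs ∷ distinct) y with x ≟ y
    ... | no _ = 𝟙-memberB xs distinct y
    ... | yes refl = cong suc (sym (trans (∑-congᴬ xs (absent xs x∉xs)) (∑-zero xs (λ _ → refl))))
      where
      absent : ∀ ys → All (λ b → ¬ x ≡ b) ys → All (λ z → 𝟙 ⌊ z ≟ x ⌋ ≡ 0) ys
      absent [] [] = []
      absent (z ∷ ys) (x≢z ∷ rest) = cong 𝟙 (⌊⌋-no (z ≟ x) (λ e → x≢z (sym e))) ∷ absent ys rest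

    countMembers : (xs : List A) → AllPairs (λ a b → ¬ a ≡ b) xs →
                   ∑ elements (λ y → 𝟙 (memberB xs y)) ≡ length xs
    countMembers xs distinct = begin
        ∑ elements (λ y → 𝟙 (memberB xs y)) ≡⟨ ∑-cong elements (𝟙-memberB xs distinct) ⟩
        ∑ elements (λ y → ∑ xs (λ x → 𝟙 ⌊ x ≟ y ⌋)) ≡⟨ ∑-swap elements xs _ ⟩
        ∑ xs (λ x → ∑ elements (λ y → 𝟙 ⌊ x ≟ y ⌋)) ≡⟨ ∑-cong xs once-sym ⟩
        ∑ xs (λ _ → 1) ≡⟨ ∑-const xs 1 ⟩
        length xs * 1 ≡⟨ *-identityʳ _ ⟩
        length xs ∎
      where open ≡-Reasoning

  finOnce : ∀ n (a : Fin n) → ∑ (allFin n) (λ y → 𝟙 ⌊ y Fin.≟ a ⌋) ≡ 1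
  finOnce (suc n) fz = cong suc (trans (∑-tabulate n fs (λ y → 𝟙 ⌊ y Fin.≟ fz ⌋))
    (∑-zero (allFin n) (λ y → cong 𝟙 (⌊⌋-no (fs y Fin.≟ fz) (λ ())))))
  finOnce (suc n) (fs a) = begin
      𝟙 ⌊ fz Fin.≟ fs a ⌋ + ∑ (tabulate fs) (λ y → 𝟙 ⌊ y Fin.≟ fs a ⌋)
        ≡⟨ cong (_+ ∑ (tabulate fs) (λ y → 𝟙 ⌊ y Fin.≟ fs a ⌋)) (cong 𝟙 (⌊⌋-no (fz Fin.≟ fs a) (λ ()))) ⟩
      ∑ (tabulate fs) (λ y → 𝟙 ⌊ y Fin.≟ fs a ⌋)
        ≡⟨ ∑-tabulate n fs (λ y → 𝟙 ⌊ y Fin.≟ fs a ⌋) ⟩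
      ∑ (allFin n) (λ y → 𝟙 ⌊ fs y Fin.≟ fs a ⌋)
        ≡⟨ ∑-cong (allFin n) (λ y → cong 𝟙 (⌊⌋-cong (fs y Fin.≟ fs a) (y Fin.≟ a) Fin.suc-injective (cong fs))) ⟩
      ∑ (allFin n) (λ y → 𝟙 ⌊ y Fin.≟ a ⌋)
        ≡⟨ finOnce n a ⟩
      1 ∎
    where open ≡-Reasoning

  finEnumeration : ∀ n → Enumeration (Fin n)
  finEnumeration n = record { elements = allFin n ; _≟_ = Fin._≟_ ; once = finOnce n }

  productEnumeration : ∀ {A B : Set} → Enumeration A → Enumeration B → Enumeration (A × B)
  productEnumeration {A} {B} EA EB = record
    { elements = cartesianProduct (elements EA) (elements EB)
    ; _≟_ = ≡-dec (_≟_ EA) (_≟_ EB)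
    ; once = productOnce }
    where
    open Enumeration
    productOnce : ∀ (a : A × B) →
      ∑ (cartesianProduct (elements EA) (elements EB)) (λ y → 𝟙 ⌊ ≡-dec (_≟_ EA) (_≟_ EB) y a ⌋) ≡ 1
    productOnce (v , i) = begin
        ∑ (cartesianProduct as bs) (λ y → 𝟙 ⌊ ≡-dec (_≟_ EA) (_≟_ EB) y (v , i) ⌋)
          ≡⟨ ∑-cartesian as bs _ ⟩
        ∑ as (λ w → ∑ bs (λ j → 𝟙 ⌊ ≡-dec (_≟_ EA) (_≟_ EB) (w , j) (v , i) ⌋))
          ≡⟨ ∑-cong as (λ w → ∑-cong bs (λ j → trans (cong 𝟙 (split w j)) (𝟙-∧ ⌊ _≟_ EA w v ⌋ ⌊ _≟_ EB j i ⌋))) ⟩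
        ∑ as (λ w → ∑ bs (λ j → 𝟙 ⌊ _≟_ EA w v ⌋ * 𝟙 ⌊ _≟_ EB j i ⌋))
          ≡⟨ ∑-cong as (λ w → trans (∑-*ˡ bs (λ j → 𝟙 ⌊ _≟_ EB j i ⌋) (𝟙 ⌊ _≟_ EA w v ⌋)) (cong (𝟙 ⌊ _≟_ EA w v ⌋ *_) (once EB i))) ⟩
        ∑ as (λ w → 𝟙 ⌊ _≟_ EA w v ⌋ * 1)
          ≡⟨ ∑-*ʳ as _ 1 ⟩
        ∑ as (λ w → 𝟙 ⌊ _≟_ EA w v ⌋) * 1
          ≡⟨ cong (_* 1) (once EA v) ⟩
        1 ∎
      where
      open ≡-Reasoning
      as : List A
      as = elements EA
      bs : List B
      bs = elements EB
      split : ∀ w j → ⌊ ≡-dec (_≟_ EA) (_≟_ EB) (w , j) (v , i) ⌋ ≡ ⌊ _≟_ EA w v ⌋ ∧ ⌊ _≟_ EB j i ⌋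
      split w j = ⌊⌋-× (≡-dec (_≟_ EA) (_≟_ EB) (w , j) (v , i)) (_≟_ EA w v) (_≟_ EB j i)
        (λ e → cong proj₁ e , cong proj₂ e) (λ { (refl , refl) → refl })

module Arithmetic where

  open import Data.Nat
  open import Data.Nat.Properties
  open import Data.Nat.DivMod using (m≡m%n+[m/n]*n)
  open import Relation.Binary.PropositionalEquality
  open import Data.Nat.Solver using (module +-*-Solver)
  open +-*-Solver

  -- Euler's formula for a plane cubic graph with n vertices, E edges and F faces,
  -- of which p are pentagons and the others hexagons, forces p = 12, so F ≥ 12 and n ≥ 20.
  twelvePentagons : ∀ n F E p → n + F ≡ E + 2 → 2 * E ≡ n * 3 → n * 3 + p ≡ F * 6 →
                    p ≤ F → 20 ≤ n
  twelvePentagons n F E p euler handshake faceSum p≤F =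
    +-cancelʳ-≤ 4 20 n (subst (24 ≤_) twiceFaces (*-monoˡ-≤ 2 (subst (_≤ F) p≡12 p≤F)))
    where
    twiceFaces : F * 2 ≡ n + 4
    twiceFaces = +-cancelˡ-≡ (n * 2) _ _ (begin
        n * 2 + F * 2 ≡⟨ solve 2 (λ n F → n :* con 2 :+ F :* con 2 := (n :+ F) :* con 2) refl n F ⟩
        (n + F) * 2   ≡⟨ cong (_* 2) euler ⟩
        (E + 2) * 2   ≡⟨ solve 1 (λ E → (E :+ con 2) :* con 2 := con 2 :* E :+ con 4) refl E ⟩
        2 * E + 4     ≡⟨ cong (_+ 4) handshake ⟩
        n * 3 + 4     ≡⟨ solve 1 (λ n → n :* con 3 :+ con 4 := n :* con 2 :+ (n :+ con 4)) refl n ⟩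
        n * 2 + (n + 4) ∎)
      where open ≡-Reasoning
    p≡12 : p ≡ 12
    p≡12 = +-cancelˡ-≡ (n * 3) _ _ (begin
        n * 3 + p     ≡⟨ faceSum ⟩
        F * 6         ≡⟨ solve 1 (λ F → F :* con 6 := (F :* con 2) :* con 3) refl F ⟩
        (F * 2) * 3   ≡⟨ cong (_* 3) twiceFaces ⟩
        (n + 4) * 3   ≡⟨ solve 1 (λ n → (n :+ con 4) :* con 3 := n :* con 3 :+ con 12) refl n ⟩
        n * 3 + 12 ∎)
      where open ≡-Reasoning

  tenEdges : ∀ n E → n % 6 ≡ 2 → 20 ≤ n → 2 * E ≡ n ∸ 6 * (n / 6 ∸ 3) → E ≡ 10
  tenEdges n E n%6≡2 20≤n twiceE = *-cancelˡ-≡ E 10 2 (trans twiceE twentyLeft)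
    where
    q t : ℕ
    q = n / 6
    t = q ∸ 3
    n≡2+6q : n ≡ 2 + q * 6
    n≡2+6q = trans (m≡m%n+[m/n]*n n 6) (cong (_+ q * 6) n%6≡2)
    3≤q : 3 ≤ q
    3≤q = *-cancelʳ-≤ 3 q 6 (+-cancelˡ-≤ 2 18 (q * 6) (subst (20 ≤_) n≡2+6q 20≤n))
    twentyLeft : n ∸ 6 * t ≡ 20
    twentyLeft = begin
        n ∸ 6 * t                 ≡⟨ cong (_∸ 6 * t) n≡2+6q ⟩
        2 + q * 6 ∸ 6 * t         ≡⟨ cong (λ m → 2 + m * 6 ∸ 6 * t) (sym (m+[n∸m]≡n 3≤q)) ⟩
        2 + (3 + t) * 6 ∸ 6 * t   ≡⟨ cong (_∸ 6 * t) (solve 1 (λ t → con 2 :+ (con 3 :+ t) :* con 6 := con 20 :+ con 6 :* t) refl t) ⟩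
        20 + 6 * t ∸ 6 * t        ≡⟨ m+n∸n≡m 20 (6 * t) ⟩
        20 ∎
      where open ≡-Reasoning

-- Vertices carry an equivalence
-- _~_ (in the application: two darts bounding the same face); an edge e is incident with
-- vertices equivalent to end₁ e or end₂ e, and it is proper when it is incident with both
-- and they are inequivalent.  A component spanned by proper edges is a connected graph, so
-- it has at most one vertex more than it has edges; if the number of edges is even, the
-- handshake parity then leaves room for at most that many odd-degree vertices.
module ComponentBound
  {V E : Set} (_~_ : V → V → Set)
  (~-refl : ∀ {x} → x ~ x) (~-sym : ∀ {x y} → x ~ y → y ~ x)
  (~-trans : ∀ {x y z} → x ~ y → y ~ z → x ~ z)
  (_~?_ : ∀ x y → Dec (x ~ y))
  (incident : E → V → Bool)
  (end₁ end₂ : E → V)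
  (incident-end : ∀ {e x} → T (incident e x) → x ~ end₁ e ⊎ x ~ end₂ e)
  (incident-resp : ∀ {e x y} → x ~ y → T (incident e x) → T (incident e y))
  (proper : E → Bool)
  (improper-loop : ∀ {e x y} → ¬ T (proper e) → T (incident e x) → T (incident e y) → x ~ y)
  (proper-end₁ : ∀ {e} → T (proper e) → T (incident e (end₁ e)))
  (proper-end₂ : ∀ {e} → T (proper e) → T (incident e (end₂ e)))
  (proper-distinct : ∀ {e} → T (proper e) → ¬ (end₁ e ~ end₂ e))
  where

  open import Data.Nat using (ℕ; suc; _+_; _*_; _≤_; _<_; z≤n; s≤s; _%_; _≤?_)
  open import Data.Nat.Properties
  open import Data.Nat.DivMod using (%-distribˡ-+; m*n%n≡0)
  open import Data.Bool using (Bool; true; false; T)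
  open import Data.List using (List; []; _∷_; length)
  open import Data.List.Relation.Unary.All as All using (All; []; _∷_)
  open import Data.List.Relation.Unary.Any as Any using (Any; here; there; any?)
  open import Data.List.Relation.Unary.AllPairs using (AllPairs; []; _∷_)
  open import Data.List.Membership.Propositional using (_∈_)
  open import Data.Product using (_×_; _,_; proj₁; proj₂)
  open import Data.Sum using (_⊎_; inj₁; inj₂) renaming (swap to ⊎-swap)
  open import Data.Empty using (⊥-elim)
  open import Data.Unit using (tt)
  open import Relation.Binary.PropositionalEquality
  open import Relation.Nullary.Decidable using (⌊_⌋; decidable-stable; toSum; ¬¬-excluded-middle)
  open import Relation.Nullary using (yes; no)
  open import Function using (_∘_; _∘′_)
  open import Defs using (countB)
  open FiniteSums
  open Truth using (⌊⌋-yes; ⌊⌋-no)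

  data Reach (Es : List E) (s : V) : V → Set where
    start : Reach Es s s
    equiv : ∀ {x y} → Reach Es s x → x ~ y → Reach Es s y
    step  : ∀ {x y} e → e ∈ Es → Reach Es s x → T (incident e x) → T (incident e y) → Reach Es s y

  Reach-trans : ∀ {Es s a x} → Reach Es s a → Reach Es a x → Reach Es s x
  Reach-trans p start = p
  Reach-trans p (equiv q x~y) = equiv (Reach-trans p q) x~y
  Reach-trans p (step e e∈ q ix iy) = step e e∈ (Reach-trans p q) ix iy

  FromEnds : List E → E → V → Set
  FromEnds Es e x = Reach Es (end₁ e) x ⊎ Reach Es (end₂ e) x

  endpoint : ∀ {Es e x} → T (incident e x) → FromEnds Es e x
  endpoint ix with incident-end ix
  ... | inj₁ x~e₁ = inj₁ (equiv start (~-sym x~e₁))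
  ... | inj₂ x~e₂ = inj₂ (equiv start (~-sym x~e₂))

  toEndpoint : ∀ {Es e s x} → Reach Es s x → T (incident e x) → Reach Es s (end₁ e) ⊎ Reach Es s (end₂ e)
  toEndpoint r ix with incident-end ix
  ... | inj₁ x~e₁ = inj₁ (equiv r x~e₁)
  ... | inj₂ x~e₂ = inj₂ (equiv r x~e₂)

  splitReach : ∀ {e Es s x} → Reach (e ∷ Es) s x →
    Reach Es s x ⊎ ((Reach Es s (end₁ e) ⊎ Reach Es s (end₂ e)) × FromEnds Es e x)
  splitReach start = inj₁ start
  splitReach (equiv r x~y) with splitReach r
  ... | inj₁ r′ = inj₁ (equiv r′ x~y)
  ... | inj₂ (toEnd , inj₁ l) = inj₂ (toEnd , inj₁ (equiv l x~y))
  ... | inj₂ (toEnd , inj₂ l) = inj₂ (toEnd , inj₂ (equiv l x~y))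
  splitReach (step e′ (here refl) r ix iy) with splitReach r
  ... | inj₁ r′ = inj₂ (toEndpoint r′ ix , endpoint iy)
  ... | inj₂ (toEnd , _) = inj₂ (toEnd , endpoint iy)
  splitReach (step e′ (there e′∈) r ix iy) with splitReach r
  ... | inj₁ r′ = inj₁ (step e′ e′∈ r′ ix iy)
  ... | inj₂ (toEnd , inj₁ l) = inj₂ (toEnd , inj₁ (step e′ e′∈ l ix iy))
  ... | inj₂ (toEnd , inj₂ l) = inj₂ (toEnd , inj₂ (step e′ e′∈ l ix iy))

  -- an improper edge only joins equivalent vertices, so it can be dropped
  dropImproper : ∀ {e Es s x} → ¬ T (proper e) → Reach (e ∷ Es) s x → Reach Es s x
  dropImproper ¬p start = start
  dropImproper ¬p (equiv r x~y) = equiv (dropImproper ¬p r) x~y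
  dropImproper ¬p (step e (here refl) r ix iy) = equiv (dropImproper ¬p r) (improper-loop ¬p ix iy)
  dropImproper ¬p (step e (there e∈) r ix iy) = step e e∈ (dropImproper ¬p r) ix iy

  Reach-[] : ∀ {s x} → Reach [] s x → s ~ x
  Reach-[] start = ~-refl
  Reach-[] (equiv r x~y) = ~-trans (Reach-[] r) x~y
  Reach-[] (step e () r ix iy)

  Distinct : List V → Set
  Distinct = AllPairs (λ a b → ¬ a ~ b)

  remove : (xs : List V) {x : V} → Any (_~ x) xs → List V
  remove (s ∷ ss) (here _) = ss
  remove (s ∷ ss) (there p) = s ∷ remove ss p

  length-remove : (xs : List V) {x : V} (p : Any (_~ x) xs) → length xs ≡ suc (length (remove xs p))
  length-remove (s ∷ ss) (here _) = refl
  length-remove (s ∷ ss) (there p) = cong suc (length-remove ss p)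

  Any-remove : (xs : List V) {x y : V} (p : Any (_~ x) xs) → Any (_~ y) xs → ¬ x ~ y →
               Any (_~ y) (remove xs p)
  Any-remove (s ∷ ss) (here s~x) (here s~y) x≁y = ⊥-elim (x≁y (~-trans (~-sym s~x) s~y))
  Any-remove (s ∷ ss) (here _) (there q) x≁y = q
  Any-remove (s ∷ ss) (there p) (here s~y) x≁y = here s~y
  Any-remove (s ∷ ss) (there p) (there q) x≁y = there (Any-remove ss p q x≁y)

  pigeonhole : (L srcs : List V) → Distinct L → All (λ x → Any (_~ x) srcs) L → length L ≤ length srcs
  pigeonhole [] srcs _ _ = z≤n
  pigeonhole (x ∷ L) srcs (x≁L ∷ distinct) (x∼ ∷ L∼) =
    subst (suc (length L) ≤_) (sym (length-remove srcs x∼))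
      (s≤s (pigeonhole L (remove srcs x∼) distinct (All.zipWith (λ (x≁y , y∼) → Any-remove srcs x∼ y∼ x≁y) (x≁L , L∼))))

  properCount : List E → ℕ
  properCount = countB proper

  byCases : ∀ {m n} (P : Set) → (P ⊎ ¬ P → m ≤ n) → m ≤ n
  byCases {m} {n} P k = decidable-stable (m ≤? n)
    (λ m≰n → ¬¬-excluded-middle (λ p? → m≰n (k (toSum p?))))

  ReachedFrom : List E → List V → V → Set
  ReachedFrom Es srcs x = Any (λ s → Reach Es s x) srcs

  splitReachedFrom : ∀ {e Es srcs x} → ReachedFrom (e ∷ Es) srcs x →
    ReachedFrom Es srcs x ⊎ ((ReachedFrom Es srcs (end₁ e) ⊎ ReachedFrom Es srcs (end₂ e)) × FromEnds Es e x)
  splitReachedFrom (here r) with splitReach r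
  ... | inj₁ r′ = inj₁ (here r′)
  ... | inj₂ (inj₁ toE₁ , l) = inj₂ (inj₁ (here toE₁) , l)
  ... | inj₂ (inj₂ toE₂ , l) = inj₂ (inj₂ (here toE₂) , l)
  splitReachedFrom (there p) with splitReachedFrom p
  ... | inj₁ q = inj₁ (there q)
  ... | inj₂ (inj₁ q , l) = inj₂ (inj₁ (there q) , l)
  ... | inj₂ (inj₂ q , l) = inj₂ (inj₂ (there q) , l)

  throughEnd : ∀ {Es srcs a b x} → ReachedFrom Es srcs a → Reach Es a x ⊎ Reach Es b x →
               ReachedFrom Es (b ∷ srcs) x
  throughEnd toA (inj₁ a→x) = there (Any.map (λ s→a → Reach-trans s→a a→x) toA)
  throughEnd toA (inj₂ b→x) = here b→x

  -- the component bound: every proper edge adds at most one new class to what the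
  -- sources reach
  componentBound : ∀ Es (srcs L : List V) → Distinct L → All (ReachedFrom Es srcs) L →
                   length L ≤ length srcs + properCount Es
  componentBound [] srcs L distinct reached = subst (length L ≤_) (sym (+-identityʳ _))
    (pigeonhole L srcs distinct (All.map (Any.map Reach-[]) reached))
  componentBound (e ∷ Es) srcs L distinct reached with proper e in eq
  ... | false = componentBound Es srcs L distinct (All.map (Any.map (dropImproper (subst T eq))) reached)
  ... | true = byCases (ReachedFrom Es srcs (end₁ e)) λ
    { (inj₁ toE₁) → oneMore (All.map (viaEnd₁ toE₁ ∘′ splitReachedFrom) reached)
    ; (inj₂ ¬toE₁) → byCases (ReachedFrom Es srcs (end₂ e)) λ
      { (inj₁ toE₂) → oneMore (All.map (viaEnd₂ toE₂ ∘′ splitReachedFrom) reached)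
      ; (inj₂ ¬toE₂) → ≤-trans
          (componentBound Es srcs L distinct (All.map (unused ¬toE₁ ¬toE₂ ∘′ splitReachedFrom) reached))
          (+-monoʳ-≤ (length srcs) (n≤1+n _)) } }
    where
    Split : V → Set
    Split x = ReachedFrom Es srcs x ⊎ ((ReachedFrom Es srcs (end₁ e) ⊎ ReachedFrom Es srcs (end₂ e)) × FromEnds Es e x)
    oneMore : ∀ {a} → All (ReachedFrom Es (a ∷ srcs)) L → length L ≤ length srcs + suc (properCount Es)
    oneMore {a} r = subst (length L ≤_) (sym (+-suc (length srcs) (properCount Es)))
                      (componentBound Es (a ∷ srcs) L distinct r)
    viaEnd₁ : ∀ {x} → ReachedFrom Es srcs (end₁ e) → Split x → ReachedFrom Es (end₂ e ∷ srcs) x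
    viaEnd₁ toE₁ (inj₁ q) = there q
    viaEnd₁ toE₁ (inj₂ (_ , l)) = throughEnd toE₁ l
    viaEnd₂ : ∀ {x} → ReachedFrom Es srcs (end₂ e) → Split x → ReachedFrom Es (end₁ e ∷ srcs) x
    viaEnd₂ toE₂ (inj₁ q) = there q
    viaEnd₂ toE₂ (inj₂ (_ , l)) = throughEnd toE₂ (⊎-swap l)
    unused : ∀ {x} → ¬ ReachedFrom Es srcs (end₁ e) → ¬ ReachedFrom Es srcs (end₂ e) →
             Split x → ReachedFrom Es srcs x
    unused _ _ (inj₁ q) = q
    unused ¬toE₁ _ (inj₂ (inj₁ toE₁ , _)) = ⊥-elim (¬toE₁ toE₁)
    unused _ ¬toE₂ (inj₂ (inj₂ toE₂ , _)) = ⊥-elim (¬toE₂ toE₂)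

  degree : List E → V → ℕ
  degree Es x = countB (λ e → incident e x) Es

  countClass : ∀ {a} (L : List V) → Distinct L → Any (_~ a) L → ∑ L (λ x → 𝟙 ⌊ x ~? a ⌋) ≡ 1
  countClass {a} (x ∷ L) (x≁L ∷ distinct) (here x~a) =
    cong₂ _+_ (cong 𝟙 (⌊⌋-yes (x ~? a) x~a))
      (trans (∑-congᴬ L (All.map (λ x≁y → cong 𝟙 (⌊⌋-no (_ ~? a) (λ y~a → x≁y (~-trans x~a (~-sym y~a))))) x≁L))
             (∑-zero L (λ _ → refl)))
  countClass {a} (x ∷ L) (x≁L ∷ distinct) (there L∋a) =
    cong₂ _+_ (cong 𝟙 (⌊⌋-no (x ~? a) x≁a)) (countClass L distinct L∋a)
    where
    x≁a : ¬ x ~ a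
    x≁a x~a = All.lookupWith (λ x≁y y~a → x≁y (~-trans x~a (~-sym y~a))) x≁L L∋a

  ∑-odd : ∀ (L : List V) (g : V → ℕ) → All (λ x → g x % 2 ≡ 1) L → ∑ L g % 2 ≡ length L % 2
  ∑-odd [] g [] = refl
  ∑-odd (x ∷ L) g (odd ∷ odds) = begin
      (g x + ∑ L g) % 2               ≡⟨ %-distribˡ-+ (g x) (∑ L g) 2 ⟩
      (g x % 2 + ∑ L g % 2) % 2       ≡⟨ cong₂ (λ a b → (a + b) % 2) odd (∑-odd L g odds) ⟩
      (1 + length L % 2) % 2          ≡⟨ sym (%-distribˡ-+ 1 (length L) 2) ⟩
      suc (length L) % 2 ∎
    where open ≡-Reasoning

  -- Suppose the bound of componentBound is attained by distinct classes L, all in the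
  -- component of f: |L| = 1 + |Es|.  Then every edge is proper and both of its ends are
  -- represented in L, so the degrees over L add up to twice the number of edges.
  module Saturated (Es : List E) (f : V) (L : List V) (distinct : Distinct L)
                   (reached : All (Reach Es f) L) (full : length L ≡ suc (length Es)) where

    bound : ∀ srcs (L′ : List V) → Distinct L′ → All (ReachedFrom Es srcs) L′ →
            length L′ ≤ length srcs + length Es
    bound srcs L′ d r = ≤-trans (componentBound Es srcs L′ d r) (+-monoʳ-≤ _ (countB≤length proper Es))

    allProper : All (T ∘ proper) Es
    allProper = countB-all proper Es (≤-antisym (countB≤length proper Es) (≤-pred atLeast))
      where
      atLeast : suc (length Es) ≤ suc (properCount Es)
      atLeast = subst (_≤ suc (properCount Es)) full
                  (componentBound Es (f ∷ []) L distinct (All.map here reached))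

    -- a class in the component of f is represented in L, or L could be extended
    represented : ∀ {a} → ¬ ¬ Reach Es f a → Any (_~ a) L
    represented {a} ¬¬f→a with any? (_~? a) L
    ... | yes L∋a = L∋a
    ... | no L∌a = ⊥-elim (¬¬f→a (λ f→a → <-irrefl refl (subst (_≤ suc (length Es)) (cong suc full)
          (bound (f ∷ []) (a ∷ L) (All.tabulate (λ {y} y∈L a~y → L∌a (Any.map (λ { refl → ~-sym a~y }) y∈L)) ∷ distinct)
                 (here f→a ∷ All.map here reached)))))

    module _ {e} (e∈Es : e ∈ Es) where

      isProper : T (proper e)
      isProper = All.lookup allProper e∈Es

      -- the ends of e lie in the component of f: otherwise they are two further classes
      -- reachable from the two sources end₁ e and f
      end₁-reached : ¬ ¬ Reach Es f (end₁ e)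
      end₁-reached ¬f→e₁ = <-irrefl refl (subst (_≤ suc (suc (length Es))) (cong (suc ∘ suc) full)
          (bound (end₁ e ∷ f ∷ []) (end₁ e ∷ end₂ e ∷ L)
             ((proper-distinct isProper ∷ unreached ¬f→e₁) ∷ unreached (λ f→e₂ → ¬f→e₁ (across f→e₂)) ∷ distinct)
             (here start ∷ here (step e e∈Es start (proper-end₁ isProper) (proper-end₂ isProper))
                        ∷ All.map (there ∘ here) reached)))
        where
        across : Reach Es f (end₂ e) → Reach Es f (end₁ e)
        across f→e₂ = step e e∈Es f→e₂ (proper-end₂ isProper) (proper-end₁ isProper)
        unreached : ∀ {x} → ¬ Reach Es f x → All (λ y → ¬ x ~ y) L
        unreached ¬f→x = All.map (λ f→y x~y → ¬f→x (equiv f→y (~-sym x~y))) reached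

      end₂-reached : ¬ ¬ Reach Es f (end₂ e)
      end₂-reached ¬f→e₂ =
        end₁-reached (λ f→e₁ → ¬f→e₂ (step e e∈Es f→e₁ (proper-end₁ isProper) (proper-end₂ isProper)))

      incidence : ∀ x → 𝟙 (incident e x) ≡ 𝟙 ⌊ x ~? end₁ e ⌋ + 𝟙 ⌊ x ~? end₂ e ⌋
      incidence x with incident e x in eq
      ... | true with incident-end {e} {x} (subst T (sym eq) tt)
      ... | inj₁ x~e₁ = sym (cong₂ _+_ (cong 𝟙 (⌊⌋-yes (x ~? end₁ e) x~e₁))
                         (cong 𝟙 (⌊⌋-no (x ~? end₂ e) (λ x~e₂ → proper-distinct isProper (~-trans (~-sym x~e₁) x~e₂)))))
      ... | inj₂ x~e₂ = sym (cong₂ _+_ (cong 𝟙 (⌊⌋-no (x ~? end₁ e) (λ x~e₁ → proper-distinct isProper (~-trans (~-sym x~e₁) x~e₂))))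
                         (cong 𝟙 (⌊⌋-yes (x ~? end₂ e) x~e₂)))
      incidence x | false = sym (cong₂ _+_
          (cong 𝟙 (⌊⌋-no (x ~? end₁ e) (λ x~e₁ → notIncident (incident-resp (~-sym x~e₁) (proper-end₁ isProper)))))
          (cong 𝟙 (⌊⌋-no (x ~? end₂ e) (λ x~e₂ → notIncident (incident-resp (~-sym x~e₂) (proper-end₂ isProper))))))
        where
        notIncident : ¬ T (incident e x)
        notIncident = subst T eq

      incidentInL : ∑ L (𝟙 ∘ incident e) ≡ 2
      incidentInL = trans (∑-cong L incidence) (trans (∑-+ L _ _)
        (cong₂ _+_ (countClass L distinct (represented end₁-reached))
                   (countClass L distinct (represented end₂-reached))))

    degreeSum : ∑ L (degree Es) ≡ length Es * 2
    degreeSum = begin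
        ∑ L (degree Es)                           ≡⟨ ∑-cong L (λ x → countB≡∑𝟙 (λ e → incident e x) Es) ⟩
        ∑ L (λ x → ∑ Es (λ e → 𝟙 (incident e x))) ≡⟨ ∑-swap L Es _ ⟩
        ∑ Es (λ e → ∑ L (𝟙 ∘ incident e))         ≡⟨ ∑-congᴬ Es (All.tabulate incidentInL) ⟩
        ∑ Es (λ _ → 2)                            ≡⟨ ∑-const Es 2 ⟩
        length Es * 2 ∎
      where open ≡-Reasoning

  oddVertexBound : ∀ Es f (L : List V) → length Es % 2 ≡ 0 → Distinct L →
                   All (λ x → Reach Es f x × degree Es x % 2 ≡ 1) L → length L ≤ length Es
  oddVertexBound Es f L even distinct oddReached with length L ≤? length Es
  ... | yes short = short
  ... | no long = ⊥-elim (0≢1+n (begin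
        0                                ≡⟨ sym (m*n%n≡0 (length Es) 2) ⟩
        length Es * 2 % 2                ≡⟨ cong (_% 2) (sym degreeSum) ⟩
        ∑ L (degree Es) % 2              ≡⟨ ∑-odd L (degree Es) (All.map proj₂ oddReached) ⟩
        length L % 2                     ≡⟨ cong (_% 2) full ⟩
        suc (length Es) % 2              ≡⟨ %-distribˡ-+ 1 (length Es) 2 ⟩
        (1 + length Es % 2) % 2          ≡⟨ cong (λ r → (1 + r) % 2) even ⟩
        1 ∎))
    where
    open ≡-Reasoning
    reached : All (Reach Es f) L
    reached = All.map proj₁ oddReached
    full : length L ≡ suc (length Es)
    full = ≤-antisym (≤-trans (componentBound Es (f ∷ []) L distinct (All.map here reached))
                              (s≤s (countB≤length proper Es)))
                     (≰⇒> long)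
    open Saturated Es f L distinct reached full

module FaceStructure (F : Fullerene) where

  open import Data.Nat using (ℕ; zero; suc; _+_; _≤_; _<_; _∸_; z≤n; s≤s; _<?_)
  open import Data.Nat.Properties
  open import Data.Bool using (Bool; true; false; T; _∧_; _xor_)
  open import Data.Bool.Properties using (xor-comm; T-∧)
  open import Data.List using (upTo)
  open import Data.List.Relation.Unary.Any.Properties using (any⁺; any⁻; applyUpTo⁺; applyUpTo⁻)
  open import Data.Fin using () renaming (zero to fz; suc to fs)
  import Data.Fin as Fin
  open import Data.Product using (Σ; _×_; _,_; proj₁; proj₂)
  open import Data.Sum using (inj₁; inj₂)
  open import Data.Empty using (⊥-elim)
  open import Data.Unit using (tt)
  open import Function using (id; Equivalence)
  open import Relation.Binary.PropositionalEquality
  open import Relation.Nullary using (yes; no)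
  open import Relation.Nullary.Decidable using (⌊_⌋; toWitness; fromWitness)
  open Fullerene F
  open Truth using (T-cong)

  faceLength-cases : ∀ d → (iter φ 5 d ≡ d × faceLen d ≡ 5) ⊎ (¬ iter φ 5 d ≡ d × faceLen d ≡ 6)
  faceLength-cases d with iter φ 5 d ≟D d
  ... | yes p = inj₁ (p , refl)
  ... | no ¬p = inj₂ (¬p , refl)

  faceLen≤6 : ∀ d → faceLen d ≤ 6
  faceLen≤6 d with faceLength-cases d
  ... | inj₁ (_ , len5) rewrite len5 = m≤n+m 5 1
  ... | inj₂ (_ , len6) rewrite len6 = ≤-refl

  5≤faceLen : ∀ d → 5 ≤ faceLen d
  5≤faceLen d with faceLength-cases d
  ... | inj₁ (_ , len5) rewrite len5 = ≤-refl
  ... | inj₂ (_ , len6) rewrite len6 = m≤m+n 5 1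

  φ-period : ∀ d → iter φ (faceLen d) d ≡ d
  φ-period d with faceLength-cases d | faceLen56 d
  ... | inj₁ (p , len5) | _ rewrite len5 = p
  ... | inj₂ (¬p , len6) | inj₁ p = ⊥-elim (¬p p)
  ... | inj₂ (_ , len6) | inj₂ p rewrite len6 = p

  iter-+ : ∀ a b d → iter φ (a + b) d ≡ iter φ a (iter φ b d)
  iter-+ zero b d = refl
  iter-+ (suc a) b d = cong φ (iter-+ a b d)

  reduce : ∀ k d → Σ ℕ λ r → r < faceLen d × iter φ k d ≡ iter φ r d
  reduce zero d = 0 , ≤-trans (s≤s z≤n) (5≤faceLen d) , refl
  reduce (suc k) d with reduce k d
  ... | r , r< , eq with suc r <? faceLen d
  ... | yes r+1< = suc r , r+1< , cong φ eq
  ... | no r+1≮ = 0 , ≤-trans (s≤s z≤n) (5≤faceLen d) , (begin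
      φ (iter φ k d)         ≡⟨ cong φ eq ⟩
      iter φ (suc r) d       ≡⟨ cong (λ m → iter φ m d) (≤-antisym r< (≮⇒≥ r+1≮)) ⟩
      iter φ (faceLen d) d   ≡⟨ φ-period d ⟩
      d ∎)
    where open ≡-Reasoning

  Orbit : Dart n → Dart n → Set
  Orbit a b = Σ ℕ λ k → iter φ k a ≡ b

  orbit-refl : ∀ {a} → Orbit a a
  orbit-refl = 0 , refl

  orbit-φ : ∀ d → Orbit d (φ d)
  orbit-φ d = 1 , refl

  orbit-trans : ∀ {a b c} → Orbit a b → Orbit b c → Orbit a c
  orbit-trans {a} (k , p) (l , q) = l + k , trans (iter-+ l k a) (trans (cong (iter φ l) p) q)

  orbit-sym : ∀ {a b} → Orbit a b → Orbit b a
  orbit-sym {a} {b} (k , p) with reduce k a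
  ... | r , r< , eq = faceLen a ∸ r , (begin
      iter φ (faceLen a ∸ r) b               ≡⟨ cong (iter φ (faceLen a ∸ r)) (trans (sym p) eq) ⟩
      iter φ (faceLen a ∸ r) (iter φ r a)    ≡⟨ sym (iter-+ (faceLen a ∸ r) r a) ⟩
      iter φ (faceLen a ∸ r + r) a           ≡⟨ cong (λ m → iter φ m a) (m∸n+n≡m (<⇒≤ r<)) ⟩
      iter φ (faceLen a) a                   ≡⟨ φ-period a ⟩
      a ∎)
    where open ≡-Reasoning

  orbit⇒sameFace : ∀ {a b} → Orbit a b → SameFace F a b
  orbit⇒sameFace {a} (k , p) with reduce k a
  ... | r , r< , eq = r , r< , trans (sym eq) p

  sameFace⇒orbit : ∀ {a b} → SameFace F a b → Orbit a b
  sameFace⇒orbit (k , _ , p) = k , p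

  sameFace-refl : ∀ {a} → SameFace F a a
  sameFace-refl = orbit⇒sameFace orbit-refl

  sameFace-sym : ∀ {a b} → SameFace F a b → SameFace F b a
  sameFace-sym p = orbit⇒sameFace (orbit-sym (sameFace⇒orbit p))

  sameFace-trans : ∀ {a b c} → SameFace F a b → SameFace F b c → SameFace F a c
  sameFace-trans p q = orbit⇒sameFace (orbit-trans (sameFace⇒orbit p) (sameFace⇒orbit q))

  sameFace? : ∀ a b → Dec (SameFace F a b)
  sameFace? a b = anyUpTo? (λ k → iter φ k a ≟D b) (faceLen a)

  onFace⇒ : ∀ {v f} → OnFace F v f → Σ ℕ λ k → k < faceLen f × vert (iter φ k f) ≡ v
  onFace⇒ {v} {f} t with applyUpTo⁻ id (any⁻ (λ k → vert (iter φ k f) ==V v) (upTo (faceLen f)) t)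
  ... | k , k< , p = k , k< , toWitness p

  ⇒onFace : ∀ {v f} k → k < faceLen f → vert (iter φ k f) ≡ v → OnFace F v f
  ⇒onFace {v} {f} k k< p = any⁺ (λ k → vert (iter φ k f) ==V v) (applyUpTo⁺ id (fromWitness p) k<)

  onFace⇒orbit : ∀ {v f} → OnFace F v f → Σ (Dart n) λ x → Orbit f x × vert x ≡ v
  onFace⇒orbit t with onFace⇒ t
  ... | k , _ , p = _ , (k , refl) , p

  orbit⇒onFace : ∀ {v f x} → Orbit f x → vert x ≡ v → OnFace F v f
  orbit⇒onFace o p with orbit⇒sameFace o
  ... | k , k< , q = ⇒onFace k k< (trans (cong vert q) p)

  onFace-resp : ∀ {v f g} → Orbit f g → OnFace F v f → OnFace F v g
  onFace-resp o t with onFace⇒orbit t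
  ... | x , o′ , p = orbit⇒onFace (orbit-trans (orbit-sym o) o′) p

  exits-resp : ∀ {e f g} → SameFace F f g → T (exitsB F e f) → T (exitsB F e g)
  exits-resp {e} s = subst T (cong₂ _xor_ (onFaceB≡ (vert e)) (onFaceB≡ (vert (α e))))
    where
    onFaceB≡ : ∀ v → onFaceB F v _ ≡ onFaceB F v _
    onFaceB≡ v = T-cong (onFace-resp (sameFace⇒orbit s)) (onFace-resp (orbit-sym (sameFace⇒orbit s)))

  exitsB-α : ∀ e f → exitsB F (α e) f ≡ exitsB F e f
  exitsB-α e f rewrite α-invol e = xor-comm (onFaceB F (vert (α e)) f) (onFaceB F (vert e) f)

  dartsAt : ∀ (d x : Dart n) → vert x ≡ vert d → x ≡ d ⊎ x ≡ σ d ⊎ x ≡ σ (σ d)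
  dartsAt (u , fz) (.u , fz) refl = inj₁ refl
  dartsAt (u , fz) (.u , fs fz) refl = inj₂ (inj₁ refl)
  dartsAt (u , fz) (.u , fs (fs fz)) refl = inj₂ (inj₂ refl)
  dartsAt (u , fs fz) (.u , fz) refl = inj₂ (inj₂ refl)
  dartsAt (u , fs fz) (.u , fs fz) refl = inj₁ refl
  dartsAt (u , fs fz) (.u , fs (fs fz)) refl = inj₂ (inj₁ refl)
  dartsAt (u , fs (fs fz)) (.u , fz) refl = inj₂ (inj₁ refl)
  dartsAt (u , fs (fs fz)) (.u , fs fz) refl = inj₂ (inj₂ refl)
  dartsAt (u , fs (fs fz)) (.u , fs (fs fz)) refl = inj₁ refl

  -- the face at the tail of the edge of d that does not contain the edge
  outerFace : Dart n → Dart n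
  outerFace d = σ (σ d)

  -- a face through the tail of d but not its head is outerFace d: the faces of d and of
  -- σ d both contain the head of d
  outerFace-unique : ∀ d g → OnFace F (vert d) g → ¬ OnFace F (vert (α d)) g → SameFace F g (outerFace d)
  outerFace-unique d g tail ¬head with onFace⇒orbit tail
  ... | x , g→x , atTail with dartsAt d x atTail
  ... | inj₁ refl = ⊥-elim (¬head (orbit⇒onFace (orbit-trans g→x (orbit-φ x)) refl))
  ... | inj₂ (inj₁ refl) = ⊥-elim (¬head (orbit⇒onFace (orbit-trans g→x (orbit-sym σd-after-αd)) refl))
    where
    σd-after-αd : Orbit (α d) (σ d)
    σd-after-αd = 1 , cong σ (α-invol d)
  ... | inj₂ (inj₂ refl) = orbit⇒sameFace g→x

  xor-cases : ∀ {a b} → T (a xor b) → (T a × ¬ T b) ⊎ (¬ T a × T b)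
  xor-cases {true} {false} _ = inj₁ (tt , λ ())
  xor-cases {false} {true} _ = inj₂ ((λ ()) , tt)

  exits⇒outer : ∀ {d g} → T (exitsB F d g) → SameFace F g (outerFace d) ⊎ SameFace F g (outerFace (α d))
  exits⇒outer {d} {g} t with xor-cases {onFaceB F (vert d) g} t
  ... | inj₁ (tail , ¬head) = inj₁ (outerFace-unique d g tail ¬head)
  ... | inj₂ (¬tail , head) =
    inj₂ (outerFace-unique (α d) g head (subst (λ z → ¬ OnFace F (vert z) g) (sym (α-invol d)) ¬tail))

  -- the edge exits both outer faces, so it is an edge between them in the associated graph
  exitsBoth : Dart n → Bool
  exitsBoth d = exitsB F d (outerFace d) ∧ exitsB F d (outerFace (α d))

  exitsBoth₁ : ∀ {d} → T (exitsBoth d) → T (exitsB F d (outerFace d))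
  exitsBoth₁ {d} t = proj₁ (Equivalence.to (T-∧ {exitsB F d (outerFace d)}) t)

  exitsBoth₂ : ∀ {d} → T (exitsBoth d) → T (exitsB F d (outerFace (α d)))
  exitsBoth₂ {d} t = proj₂ (Equivalence.to (T-∧ {exitsB F d (outerFace d)}) t)

  exitsBoth-intro : ∀ {d} → T (exitsB F d (outerFace d)) → T (exitsB F d (outerFace (α d))) → T (exitsBoth d)
  exitsBoth-intro {d} t₁ t₂ = Equivalence.from (T-∧ {exitsB F d (outerFace d)}) (t₁ , t₂)

  exitsOne : ∀ {d x y} → ¬ T (exitsBoth d) → T (exitsB F d x) → T (exitsB F d y) → SameFace F x y
  exitsOne {d} ¬both tx ty with exits⇒outer {d} tx | exits⇒outer {d} ty
  ... | inj₁ p | inj₁ q = sameFace-trans p (sameFace-sym q)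
  ... | inj₂ p | inj₂ q = sameFace-trans p (sameFace-sym q)
  ... | inj₁ p | inj₂ q = ⊥-elim (¬both (exitsBoth-intro {d} (exits-resp p tx) (exits-resp q ty)))
  ... | inj₂ p | inj₁ q = ⊥-elim (¬both (exitsBoth-intro {d} (exits-resp q ty) (exits-resp p tx)))

  exitsBoth-distinct : ∀ {d} → T (exitsBoth d) → ¬ SameFace F (outerFace d) (outerFace (α d))
  exitsBoth-distinct {d} t s with xor-cases {onFaceB F (vert d) (outerFace d)} (exitsBoth₁ {d} t)
  ... | inj₁ (_ , ¬head) = ¬head (orbit⇒onFace (sameFace⇒orbit s) refl)
  ... | inj₂ (¬tail , _) = ¬tail (orbit⇒onFace orbit-refl refl)

module Counting (F : Fullerene) where

  open import Data.Nat using (ℕ; zero; suc; _+_; _*_; _≤_; _<_; _∸_; s≤s; _≤ᵇ_; _<ᵇ_; _%_)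
  open import Data.Nat.Properties
  open import Data.Nat.DivMod using (m*n%n≡0; [m+kn]%n≡m%n; m<n⇒m%n≡m)
  open import Data.Bool using (Bool; true; false; T; _∧_; _∨_; not)
  open import Data.Bool.Properties using (T-∧; T-≡)
  open import Data.Bool.ListAction using (or)
  open import Data.List using (List; []; _∷_; length; map; applyUpTo; upTo; allFin)
  open import Data.List.Properties using (map-applyUpTo; length-applyUpTo; length-tabulate)
  open import Data.List.Relation.Unary.All as All using (All; []; _∷_)
  open import Data.List.Relation.Unary.All.Properties as All using (all⁺; all⁻)
  open import Data.List.Relation.Unary.Any.Properties using (any⁻; any⁺; applyUpTo⁻; applyUpTo⁺)
  open import Data.List.Relation.Unary.AllPairs using (AllPairs; []; _∷_)
  import Data.List.Relation.Unary.AllPairs.Properties as AllPairs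
  open import Data.List.Extrema.Nat using (argmin; f[argmin]≤f[⊤]; f[argmin]≤f[xs]; argmin-all)
  open import Data.Fin using (Fin; toℕ)
  import Data.Fin as Fin
  import Data.Fin.Properties as Fin
  open import Data.Product using (_×_; _,_; proj₁; proj₂)
  open import Data.Sum using (inj₁; inj₂)
  open import Data.Empty using (⊥; ⊥-elim)
  open import Data.Unit using (tt)
  open import Function using (id; _∘_; Equivalence)
  open import Relation.Binary.Definitions using (tri<; tri≈; tri>)
  open import Relation.Binary.PropositionalEquality
  open import Relation.Nullary.Decidable using (⌊_⌋; toWitness; fromWitness)
  open Fullerene F
  open Truth
  open FiniteSums
  open Enumerations
  open FaceStructure F

  dartEnumeration : Enumeration (Dart n)
  dartEnumeration = productEnumeration (finEnumeration n) (finEnumeration 3)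

  open Enumeration using (memberB; countMembers; ∑-sift; ∑-reindex)

  idx-injective : ∀ {a b : Dart n} → idx a ≡ idx b → a ≡ b
  idx-injective {v , i} {w , j} eq = cong₂ _,_ (Fin.toℕ-injective v≡w) (Fin.toℕ-injective i≡j)
    where
    digit : ∀ a x → x < 3 → (3 * a + x) % 3 ≡ x
    digit a x x<3 = trans (cong (_% 3) (trans (+-comm (3 * a) x) (cong (x +_) (*-comm 3 a))))
                      (trans ([m+kn]%n≡m%n x a 3) (m<n⇒m%n≡m x<3))
    i≡j : toℕ i ≡ toℕ j
    i≡j = trans (sym (digit (toℕ v) (toℕ i) (Fin.toℕ<n i)))
            (trans (cong (_% 3) eq) (digit (toℕ w) (toℕ j) (Fin.toℕ<n j)))
    v≡w : toℕ v ≡ toℕ w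
    v≡w = *-cancelˡ-≡ (toℕ v) (toℕ w) 3 (+-cancelʳ-≡ (toℕ i) _ _ (trans eq (cong (3 * toℕ w +_) (sym i≡j))))

  idx-α : ∀ e → ¬ idx e ≡ idx (α e)
  idx-α e eq = noLoop e (cong vert (sym (idx-injective eq)))

  canonical : Dart n → Bool
  canonical d = idx d <ᵇ idx (α d)

  oneOrder : ∀ {a b} → ¬ a ≡ b → 𝟙 (a <ᵇ b) + 𝟙 (b <ᵇ a) ≡ 1
  oneOrder {a} {b} a≢b with <-cmp a b
  ... | tri< a<b _ b≮a = cong₂ _+_ (cong 𝟙 (Equivalence.to T-≡ (<⇒<ᵇ a<b))) (cong 𝟙 (T-false (b≮a ∘ <ᵇ⇒< b a)))
  ... | tri≈ _ a≡b _ = ⊥-elim (a≢b a≡b)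
  ... | tri> a≮b _ b<a = cong₂ _+_ (cong 𝟙 (T-false (a≮b ∘ <ᵇ⇒< a b))) (cong 𝟙 (Equivalence.to T-≡ (<⇒<ᵇ b<a)))

  halfCount : (N : Dart n → Bool) → (∀ d → N d ≡ N (α d)) →
    ∑ (allDarts n) (𝟙 ∘ N) ≡ 2 * countB (λ d → N d ∧ canonical d) (allDarts n)
  halfCount N N-sym = begin
      ∑ D (𝟙 ∘ N)                                              ≡⟨ ∑-cong D orientations ⟩
      ∑ D (λ d → 𝟙 (N d ∧ canonical d) + 𝟙 (N d ∧ canonical (α d))) ≡⟨ ∑-+ D _ _ ⟩
      ∑ D (λ d → 𝟙 (N d ∧ canonical d)) + ∑ D (λ d → 𝟙 (N d ∧ canonical (α d)))
        ≡⟨ cong (∑ D (λ d → 𝟙 (N d ∧ canonical d)) +_) flipped ⟩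
      ∑ D (λ d → 𝟙 (N d ∧ canonical d)) + ∑ D (λ d → 𝟙 (N d ∧ canonical d))
        ≡⟨ cong (λ z → z + z) (sym (countB≡∑𝟙 _ D)) ⟩
      countB (λ d → N d ∧ canonical d) D + countB (λ d → N d ∧ canonical d) D
        ≡⟨ cong (countB (λ d → N d ∧ canonical d) D +_) (sym (+-identityʳ _)) ⟩
      2 * countB (λ d → N d ∧ canonical d) D ∎
    where
    open ≡-Reasoning
    D : List (Dart n)
    D = allDarts n
    orientations : ∀ d → 𝟙 (N d) ≡ 𝟙 (N d ∧ canonical d) + 𝟙 (N d ∧ canonical (α d))
    orientations d with N d
    ... | false = refl
    ... | true = trans (sym (oneOrder (idx-α d)))
                       (cong (λ z → 𝟙 (canonical d) + 𝟙 (idx (α d) <ᵇ idx z)) (sym (α-invol d)))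
    flipped : ∑ D (λ d → 𝟙 (N d ∧ canonical (α d))) ≡ ∑ D (λ d → 𝟙 (N d ∧ canonical d))
    flipped = trans (∑-cong D (λ d → cong (λ b → 𝟙 (b ∧ canonical (α d))) (N-sym d)))
                    (∑-reindex dartEnumeration α α α-invol α-invol (λ d → 𝟙 (N d ∧ canonical d)))

  -- the darts of the face of r, in boundary order; they are distinct since the boundary
  -- vertices are
  orbitList : Dart n → List (Dart n)
  orbitList r = applyUpTo (λ k → iter φ k r) (faceLen r)

  orbitList-distinct : ∀ r → AllPairs (λ a b → ¬ a ≡ b) (orbitList r)
  orbitList-distinct r = AllPairs.applyUpTo⁺₁ (λ k → iter φ k r) (faceLen r)
    (λ {i} {j} i<j j<len eq → <⇒≢ i<j (faceCycle r i j (<-trans i<j j<len) j<len (cong vert eq)))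

  inFace : Dart n → Dart n → Bool
  inFace r = memberB dartEnumeration (orbitList r)

  inFace⇒orbit : ∀ {r d} → T (inFace r d) → Orbit r d
  inFace⇒orbit {r} {d} t with applyUpTo⁻ (λ k → iter φ k r) (any⁻ (λ x → ⌊ x ≟D d ⌋) (orbitList r) t)
  ... | k , _ , p = k , toWitness p

  orbit⇒inFace : ∀ {r d} → Orbit r d → T (inFace r d)
  orbit⇒inFace {r} {d} o with orbit⇒sameFace o
  ... | k , k< , p = any⁺ (λ x → ⌊ x ≟D d ⌋) (applyUpTo⁺ (λ k → iter φ k r) (fromWitness p) k<)

  faceDarts : ∀ r → ∑ (allDarts n) (𝟙 ∘ inFace r) ≡ faceLen r
  faceDarts r = trans (countMembers dartEnumeration (orbitList r) (orbitList-distinct r))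
                      (length-applyUpTo _ (faceLen r))

  successors : Dart n → List (Dart n)
  successors d = applyUpTo (λ k → iter φ (suc k) d) 5

  -- the dart of least code on the face of d; isRep singles these darts out
  representative : Dart n → Dart n
  representative d = argmin idx d (successors d)

  representative-orbit : ∀ d → Orbit d (representative d)
  representative-orbit d = argmin-all idx {P = Orbit d} orbit-refl
    (All.applyUpTo⁺₂ {P = Orbit d} (λ k → iter φ (suc k) d) 5 (λ k → suc k , refl))

  representative-belowSix : ∀ d r → r < 6 → idx (representative d) ≤ idx (iter φ r d)
  representative-belowSix d zero _ = f[argmin]≤f[⊤] {f = idx} d (successors d)
  representative-belowSix d (suc r) (s≤s r<5) =
    All.applyUpTo⁻ {P = λ x → idx (representative d) ≤ idx x} (λ k → iter φ (suc k) d) 5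
      (f[argmin]≤f[xs] {f = idx} d (successors d)) r<5

  representative-minimal : ∀ d k → idx (representative d) ≤ idx (iter φ k d)
  representative-minimal d k =
    let r , r< , eq = reduce k d in
    subst (λ x → idx (representative d) ≤ idx x) (sym eq) (representative-belowSix d r (≤-trans r< (faceLen≤6 d)))

  isRep-minimal : ∀ {r} → T (isRep r) → ∀ k → idx r ≤ idx (iter φ k r)
  isRep-minimal {r} t k =
    let j , j< , eq = reduce k r in
    subst (λ x → idx r ≤ idx x) (sym eq) (≤ᵇ⇒≤ (idx r) (idx (iter φ j r)) (belowSix (≤-trans j< (faceLen≤6 r))))
    where
    belowSix : ∀ {j} → j < 6 → T (idx r ≤ᵇ idx (iter φ j r))
    belowSix = All.applyUpTo⁻ {P = λ j → T (idx r ≤ᵇ idx (iter φ j r))} id 6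
                 (all⁺ (λ j → idx r ≤ᵇ idx (iter φ j r)) (upTo 6) t)

  isRep-representative : ∀ d → T (isRep (representative d))
  isRep-representative d =
    all⁻ (λ k → idx rd ≤ᵇ idx (iter φ k rd)) {xs = upTo 6}
      (All.applyUpTo⁺₂ {P = λ k → T (idx rd ≤ᵇ idx (iter φ k rd))} id 6 below)
    where
    rd : Dart n
    rd = representative d
    below : ∀ k → T (idx rd ≤ᵇ idx (iter φ k rd))
    below k =
      let j , d→rd = representative-orbit d in
      ≤⇒≤ᵇ (subst (λ x → idx rd ≤ idx x) (trans (iter-+ k j d) (cong (iter φ k) d→rd))
                  (representative-minimal d (k + j)))

  representative-unique : ∀ r d → (r ==D representative d) ≡ (isRep r ∧ inFace r d)
  representative-unique r d = T-cong to from
    where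
    to : T (r ==D representative d) → T (isRep r ∧ inFace r d)
    to t = subst (λ x → T (isRep x ∧ inFace x d)) (sym (toWitness {a? = r ≟D representative d} t))
      (Equivalence.from (T-∧ {isRep (representative d)} {inFace (representative d) d})
        (isRep-representative d , orbit⇒inFace (orbit-sym (representative-orbit d))))
    from : T (isRep r ∧ inFace r d) → T (r ==D representative d)
    from t = fromWitness {a? = r ≟D representative d} (idx-injective (≤-antisym r≤rep rep≤r))
      where
      rep-r : T (isRep r) × T (inFace r d)
      rep-r = Equivalence.to (T-∧ {isRep r} {inFace r d}) t
      r→d : Orbit r d
      r→d = inFace⇒orbit (proj₂ rep-r)
      r≤rep : idx r ≤ idx (representative d)
      r≤rep = let k , p = orbit-trans r→d (representative-orbit d) in
              subst (λ x → idx r ≤ idx x) p (isRep-minimal (proj₁ rep-r) k)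
      rep≤r : idx (representative d) ≤ idx r
      rep≤r = let k , p = orbit-sym r→d in
              subst (λ x → idx (representative d) ≤ idx x) p (representative-minimal d k)

  dartsByFace : ∑ (allDarts n) (λ _ → 1) ≡ ∑ (allDarts n) (λ r → 𝟙 (isRep r) * faceLen r)
  dartsByFace = begin
      ∑ D (λ _ → 1)                                          ≡⟨ ∑-cong D (λ d → sym (∑-sift dartEnumeration (representative d) (λ _ → 1))) ⟩
      ∑ D (λ d → ∑ D (λ r → 𝟙 (r ==D representative d) * 1))  ≡⟨ ∑-cong D (λ d → ∑-cong D (λ r → indicator r d)) ⟩
      ∑ D (λ d → ∑ D (λ r → 𝟙 (isRep r) * 𝟙 (inFace r d)))   ≡⟨ ∑-swap D D _ ⟩
      ∑ D (λ r → ∑ D (λ d → 𝟙 (isRep r) * 𝟙 (inFace r d)))   ≡⟨ ∑-cong D (λ r → ∑-*ˡ D (𝟙 ∘ inFace r) (𝟙 (isRep r))) ⟩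
      ∑ D (λ r → 𝟙 (isRep r) * ∑ D (𝟙 ∘ inFace r))           ≡⟨ ∑-cong D (λ r → cong (𝟙 (isRep r) *_) (faceDarts r)) ⟩
      ∑ D (λ r → 𝟙 (isRep r) * faceLen r) ∎
    where
    open ≡-Reasoning
    D : List (Dart n)
    D = allDarts n
    indicator : ∀ r d → 𝟙 (r ==D representative d) * 1 ≡ 𝟙 (isRep r) * 𝟙 (inFace r d)
    indicator r d = trans (*-identityʳ _) (trans (cong 𝟙 (representative-unique r d)) (𝟙-∧ (isRep r) (inFace r d)))

  pentagons : ℕ
  pentagons = ∑ (allDarts n) (λ r → 𝟙 (isRep r) * (6 ∸ faceLen r))

  faceLengthSum : ∑ (allDarts n) (λ r → 𝟙 (isRep r) * faceLen r) + pentagons ≡ numFaces * 6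
  faceLengthSum = begin
      ∑ D (λ r → 𝟙 (isRep r) * faceLen r) + pentagons
        ≡⟨ sym (∑-+ D _ _) ⟩
      ∑ D (λ r → 𝟙 (isRep r) * faceLen r + 𝟙 (isRep r) * (6 ∸ faceLen r))
        ≡⟨ ∑-cong D (λ r → trans (sym (*-distribˡ-+ (𝟙 (isRep r)) (faceLen r) (6 ∸ faceLen r)))
                                 (cong (𝟙 (isRep r) *_) (m+[n∸m]≡n (faceLen≤6 r)))) ⟩
      ∑ D (λ r → 𝟙 (isRep r) * 6)  ≡⟨ ∑-*ʳ D _ 6 ⟩
      ∑ D (𝟙 ∘ isRep) * 6          ≡⟨ cong (_* 6) (sym (countB≡∑𝟙 isRep D)) ⟩
      numFaces * 6 ∎
    where
    open ≡-Reasoning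
    D : List (Dart n)
    D = allDarts n

  pentagons≤faces : pentagons ≤ numFaces
  pentagons≤faces = subst (pentagons ≤_) (sym (countB≡∑𝟙 isRep (allDarts n)))
    (∑-mono (allDarts n) (λ r → ≤-trans (*-monoʳ-≤ (𝟙 (isRep r)) (∸-monoʳ-≤ 6 (5≤faceLen r)))
                                        (≤-reflexive (*-identityʳ _))))

  dartCount : ∑ (allDarts n) (λ _ → 1) ≡ n * 3
  dartCount = trans (∑-cartesian (allFin n) (allFin 3) (λ _ → 1))
                    (trans (∑-const (allFin n) 3) (cong (_* 3) (length-tabulate {n = n} id)))

  20≤n : 20 ≤ n
  20≤n = Arithmetic.twelvePentagons n numFaces numEdges pentagons euler
    (trans (sym (halfCount (λ _ → true) (λ _ → refl))) dartCount)
    (trans (cong (_+ pentagons) (trans (sym dartCount) dartsByFace)) faceLengthSum)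
    pentagons≤faces

  vertexList : Dart n → List (Fin n)
  vertexList h = applyUpTo (λ k → vert (iter φ k h)) (faceLen h)

  vertexList-distinct : ∀ h → AllPairs (λ a b → ¬ a ≡ b) (vertexList h)
  vertexList-distinct h = AllPairs.applyUpTo⁺₁ (λ k → vert (iter φ k h)) (faceLen h)
    (λ {i} {j} i<j j<len eq → <⇒≢ i<j (faceCycle h i j (<-trans i<j j<len) j<len eq))

  faceVertices : ∀ h → countB (λ v → onFaceB F v h) (allFin n) ≡ faceLen h
  faceVertices h = begin
      countB (λ v → onFaceB F v h) (allFin n)                  ≡⟨ countB≡∑𝟙 _ (allFin n) ⟩
      ∑ (allFin n) (λ v → 𝟙 (onFaceB F v h))                   ≡⟨ ∑-cong (allFin n) (λ v → cong 𝟙 (onFaceB≡memberB v)) ⟩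
      ∑ (allFin n) (λ v → 𝟙 (memberB (finEnumeration n) (vertexList h) v))
        ≡⟨ countMembers (finEnumeration n) (vertexList h) (vertexList-distinct h) ⟩
      length (vertexList h)                                    ≡⟨ length-applyUpTo _ (faceLen h) ⟩
      faceLen h ∎
    where
    open ≡-Reasoning
    onFaceB≡memberB : ∀ v → onFaceB F v h ≡ memberB (finEnumeration n) (vertexList h) v
    onFaceB≡memberB v = cong or (trans (map-applyUpTo id (λ k → vert (iter φ k h) ==V v) (faceLen h))
      (sym (map-applyUpTo (λ k → vert (iter φ k h)) (λ x → ⌊ x Fin.≟ v ⌋) (faceLen h))))

  coveredCount : ∀ H → AllPairs (DistinctDisjoint F) H → countB (coveredBy F H) (allFin n) ≡ ∑ H faceLen
  coveredCount [] [] = trans (countB≡∑𝟙 _ (allFin n)) (∑-zero (allFin n) (λ _ → refl))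
  coveredCount (h ∷ H) (h#H ∷ disjoint) = begin
      countB (coveredBy F (h ∷ H)) (allFin n)                   ≡⟨ countB≡∑𝟙 _ (allFin n) ⟩
      ∑ (allFin n) (λ v → 𝟙 (onFaceB F v h ∨ coveredBy F H v))  ≡⟨ ∑-cong (allFin n) (λ v → 𝟙-∨ (notBoth v)) ⟩
      ∑ (allFin n) (λ v → 𝟙 (onFaceB F v h) + 𝟙 (coveredBy F H v))
        ≡⟨ ∑-+ (allFin n) _ _ ⟩
      ∑ (allFin n) (λ v → 𝟙 (onFaceB F v h)) + ∑ (allFin n) (𝟙 ∘ coveredBy F H)
        ≡⟨ cong₂ _+_ (sym (countB≡∑𝟙 _ (allFin n))) (sym (countB≡∑𝟙 _ (allFin n))) ⟩
      countB (λ v → onFaceB F v h) (allFin n) + countB (coveredBy F H) (allFin n)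
        ≡⟨ cong₂ _+_ (faceVertices h) (coveredCount H disjoint) ⟩
      faceLen h + ∑ H faceLen ∎
    where
    open ≡-Reasoning
    notBoth : ∀ v → T (onFaceB F v h) → T (coveredBy F H v) → ⊥
    notBoth v onH covered =
      All.lookupWith (λ h#g onG → proj₂ h#g v onH onG) h#H (any⁻ (onFaceB F v) H covered)

  -- an alternating face has even length, so it is a hexagon
  alternating⇒hexagon : ∀ {M h} → Alternating F M h → faceLen h ≡ 6
  alternating⇒hexagon {M} {h} alt with faceLength-cases h
  ... | inj₂ (_ , len6) = len6
  ... | inj₁ (_ , len5) = ⊥-elim (1≢0 (begin
        1                     ≡⟨ cong (_% 2) (sym len5) ⟩
        faceLen h % 2         ≡⟨ cong (_% 2) (sym alt) ⟩
        2 * matched % 2       ≡⟨ cong (_% 2) (*-comm 2 matched) ⟩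
        matched * 2 % 2       ≡⟨ m*n%n≡0 matched 2 ⟩
        0 ∎))
    where
    open ≡-Reasoning
    matched : ℕ
    matched = countB (λ k → M (iter φ k h)) (upTo (faceLen h))
    1≢0 : ¬ 1 ≡ 0
    1≢0 ()

  matchingSize : ∀ removed M → IsPerfectMatchingOf F removed M →
                 2 * edgeCount F M ≡ countB (not ∘ removed) (allFin n)
  matchingSize removed M (M-sym , avoids , perfect) = begin
      2 * edgeCount F M                                       ≡⟨ sym (halfCount M M-sym) ⟩
      ∑ (allDarts n) (𝟙 ∘ M)                                  ≡⟨ ∑-cartesian (allFin n) (allFin 3) _ ⟩
      ∑ (allFin n) (λ v → ∑ (allFin 3) (λ i → 𝟙 (M (v , i)))) ≡⟨ ∑-cong (allFin n) atVertex ⟩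
      ∑ (allFin n) (λ v → 𝟙 (not (removed v)))               ≡⟨ sym (countB≡∑𝟙 _ (allFin n)) ⟩
      countB (not ∘ removed) (allFin n) ∎
    where
    open ≡-Reasoning
    atVertex : ∀ v → ∑ (allFin 3) (λ i → 𝟙 (M (v , i))) ≡ 𝟙 (not (removed v))
    atVertex v with removed v in eq
    ... | true = ∑-zero (allFin 3) unmatched
      where
      unmatched : ∀ i → 𝟙 (M (v , i)) ≡ 0
      unmatched i with M (v , i) in matched
      ... | true = ⊥-elim (avoids (v , i) (subst T (sym matched) tt) (subst T (sym eq) tt))
      ... | false = refl
    ... | false = trans (sym (countB≡∑𝟙 (λ i → M (v , i)) (allFin 3))) (perfect v (subst T eq))

  matchingOutsidePattern : ∀ H M → IsResonantPattern F H → IsPerfectMatchingOf F (coveredBy F H) M →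
                           2 * edgeCount F M ≡ n ∸ 6 * length H
  matchingOutsidePattern H M (disjoint , (M′ , _ , alternating)) perfect = begin
      2 * edgeCount F M                              ≡⟨ matchingSize (coveredBy F H) M perfect ⟩
      countB (not ∘ coveredBy F H) (allFin n)        ≡⟨ sym (m+n∸n≡m _ (countB (coveredBy F H) (allFin n))) ⟩
      countB (not ∘ coveredBy F H) (allFin n) + countB (coveredBy F H) (allFin n) ∸ countB (coveredBy F H) (allFin n)
        ≡⟨ cong₂ _∸_ (trans (countB-not (coveredBy F H) (allFin n)) (length-tabulate {n = n} id)) coveredByHexagons ⟩
      n ∸ 6 * length H ∎
    where
    open ≡-Reasoning
    coveredByHexagons : countB (coveredBy F H) (allFin n) ≡ 6 * length H
    coveredByHexagons = begin
        countB (coveredBy F H) (allFin n)   ≡⟨ coveredCount H disjoint ⟩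
        ∑ H faceLen                         ≡⟨ ∑-congᴬ H (All.map (alternating⇒hexagon {M′}) alternating) ⟩
        ∑ H (λ _ → 6)                       ≡⟨ ∑-const H 6 ⟩
        length H * 6                        ≡⟨ *-comm (length H) 6 ⟩
        6 * length H ∎

-- The M-associated graph of a matching M of F: its vertices are faces (darts up to SameFace),
-- and each edge of M, represented by its canonical dart, joins the faces it exits.
module AssociatedGraph (F : Fullerene) (M : EdgeSet F) (M-sym : ∀ d → M d ≡ M (Fullerene.α F d)) where

  open import Data.Nat using (_<ᵇ_; _%_; _≤_)
  open import Data.Nat.Properties using (<-cmp; <⇒<ᵇ)
  open import Data.Bool using (Bool; T; _∧_)
  open import Data.Bool.Properties using (∧-assoc; T-∧)
  open import Data.List using (List; length; filterᵇ)
  open import Data.List.Membership.Propositional using (_∈_)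
  open import Data.List.Membership.Propositional.Properties using (∈-filter⁺; ∈-cartesianProduct⁺; ∈-allFin)
  open import Data.List.Relation.Unary.All as All using (All)
  open import Data.Product using (Σ; _×_; _,_)
  open import Data.Empty using (⊥-elim)
  open import Function using (_∘_; Equivalence)
  open import Relation.Binary.Definitions using (tri<; tri≈; tri>)
  open import Relation.Binary.PropositionalEquality
  open import Relation.Nullary.Decidable using (T?)
  open Fullerene F
  open FiniteSums
  open FaceStructure F
  open Counting F using (canonical; idx-α)

  inM : Dart n → Bool
  inM d = M d ∧ canonical d

  edges : List (Dart n)
  edges = filterᵇ inM (allDarts n)

  open ComponentBound (SameFace F) sameFace-refl sameFace-sym sameFace-trans sameFace?
    (exitsB F) outerFace (outerFace ∘ α) exits⇒outer exits-resp
    exitsBoth exitsOne exitsBoth₁ exitsBoth₂ exitsBoth-distinct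

  listed : ∀ d → T (inM d) → d ∈ edges
  listed (v , i) = ∈-filter⁺ (T? ∘ inM) (∈-cartesianProduct⁺ (∈-allFin v) (∈-allFin i))

  canonicalDart : ∀ e → T (M e) → Σ (Dart n) λ e′ → e′ ∈ edges × (∀ g → exitsB F e′ g ≡ exitsB F e g)
  canonicalDart e Me with <-cmp (idx e) (idx (α e))
  ... | tri< e< _ _ = e , listed e (Equivalence.from T-∧ (Me , <⇒<ᵇ e<)) , (λ _ → refl)
  ... | tri≈ _ same _ = ⊥-elim (idx-α e same)
  ... | tri> _ _ e> = α e , listed (α e) (Equivalence.from T-∧ (subst T (M-sym e) Me , αe-canonical)) , exitsB-α e
    where
    αe-canonical : T (canonical (α e))
    αe-canonical = subst (λ z → T (idx (α e) <ᵇ idx z)) (sym (α-invol e)) (<⇒<ᵇ e>)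

  assocReach⇒Reach : ∀ {f g} → AssocReach F M f g → Reach edges f g
  assocReach⇒Reach r-refl = start
  assocReach⇒Reach (r-same r s) = equiv (assocReach⇒Reach r) s
  assocReach⇒Reach (r-edge {g} {h} e r (Me , exits-g) (_ , exits-h)) =
    let e′ , e′∈ , same = canonicalDart e Me in
    step e′ e′∈ (assocReach⇒Reach r) (subst T (sym (same g)) exits-g) (subst T (sym (same h)) exits-h)

  assocDegree≡degree : ∀ g → assocDegree F M g ≡ degree edges g
  assocDegree≡degree g =
    trans (countB-cong (allDarts n) (λ d → sym (∧-assoc (M d) (canonical d) (exitsB F d g))))
          (sym (countB-filterᵇ inM (λ e → exitsB F e g) (allDarts n)))

  oddFaceBound : edgeCount F M % 2 ≡ 0 → ∀ f (L : List (Dart n)) →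
    AllPairs (λ g h → ¬ SameFace F g h) L →
    All (λ g → AssocReach F M f g × assocDegree F M g % 2 ≡ 1) L → length L ≤ edgeCount F M
  oddFaceBound even f L distinct oddReached =
    subst (length L ≤_) |edges|
      (oddVertexBound edges f L (trans (cong (_% 2) |edges|) even) distinct
        (All.map (λ { (r , odd) → assocReach⇒Reach r , subst (λ k → k % 2 ≡ 1) (assocDegree≡degree _) odd }) oddReached))
    where
    |edges| : length edges ≡ edgeCount F M
    |edges| = length-filterᵇ inM (allDarts n)

lemma5p1 : (F : Fullerene) →
    Fullerene.n F % 6 ≡ 2 →
    IsClarNumber F (Fullerene.n F / 6 ∸ 3) →
    (H : List (Dart (Fullerene.n F))) (M : EdgeSet F) →
    IsClarStructure F H M →
    (edgeCount F M ≡ 10) ×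
    ((f : Dart (Fullerene.n F)) → IsAssocVertex F M f →
      (L : List (Dart (Fullerene.n F))) →
      AllPairs (λ g h → ¬ SameFace F g h) L →
      All (λ g → AssocReach F M f g × assocDegree F M g % 2 ≡ 1) L →
      length L ≤ 10)
lemma5p1 F n%6≡2 ((H₀ , resonant₀ , |H₀|) , clarBound) H M ((resonant , maximal) , perfect) =
  tenEdges , λ f _ L distinct oddReached →
    subst (length L ≤_) tenEdges (oddFaceBound (cong (_% 2) tenEdges) f L distinct oddReached)
  where
  open import Data.Nat.Properties using (≤-antisym)
  open import Relation.Binary.PropositionalEquality using (cong; trans; subst)
  open import Data.Nat using (_*_)
  open Fullerene F using (n)
  open AssociatedGraph F M (proj₁ perfect) using (oddFaceBound)
  -- both H and H₀ are maximum resonant patterns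
  |H| : length H ≡ n / 6 ∸ 3
  |H| = ≤-antisym (clarBound H resonant) (subst (_≤ length H) |H₀| (maximal H₀ resonant₀))
  tenEdges : edgeCount F M ≡ 10
  tenEdges = Arithmetic.tenEdges n (edgeCount F M) n%6≡2 (Counting.20≤n F)
    (trans (Counting.matchingOutsidePattern F H M resonant perfect) (cong (λ h → n ∸ 6 * h) |H|))
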